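{- Let $\mathbf V$ be a commutative unital quantale, let $\mathbf L_1,\mathbf L_2$ be $\mathbf V$-modules, $\mathbf H=(\mathbf A,F)$ a $\mathbf V$-F-semilattice and $f\colon\mathbf L_1\to\mathbf L_2$ a module homomorphism. Then the map $\mathbf J[\mathbf H,f]\colon T_{[\mathbf H,\mathbf L_1]}\to T_{[\mathbf H,\mathbf L_2]}$, $(\mathbf J[\mathbf H,f](\alpha))(x)=f(\alpha(x))$ ($\alpha\in T_{[\mathbf H,\mathbf L_1]}$, $x\in A$), is a well-defined homomorphism of $\mathbf V$-frames $\mathbf J[\mathbf H,\mathbf L_1]\to\mathbf J[\mathbf H,\mathbf L_2]$. Moreover, $\mathbf J[\mathbf H,-]$ is a functor from $\mathbf V$-$\mathbb S$ to $\mathbf V$-$\mathbb J$.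
   Context: A commutative unital quantale $\mathbf V=(V,\bigvee,\otimes,e)$: complete lattice, commutative monoid, $\otimes$ distributing over arbitrary joins. A $\mathbf V$-module $(A,\bigvee,*)$: complete lattice with $*\colon V\times A\to A$ preserving joins in each argument, $u*(v*a)=(u\otimes v)*a$, $e*a=a$; module homomorphisms preserve arbitrary joins and the action; $\mathbf V$-$\mathbb S$ is their category. A $\mathbf V$-frame is $(T,r)$ with $r\colon T\times T\to V$; a frame homomorphism $g\colon(T,r)\to(S,s)$ is a map with $r(i,j)\le s(g(i),g(j))$; $\mathbf V$-$\mathbb J$ is the category of frames. A $\mathbf V$-F-semilattice is $(\mathbf A,F)$ with $F$ a module endomorphism. For a module $\mathbf L$ and $a,b\in L$, $a\rightarrow b=\bigvee\{v\in V\mid v*a\le b\}$. $T_{[\mathbf H,\mathbf L]}$ is the set of module homomorphisms $\mathbf A\to\mathbf L$, and $\mathbf J[\mathbf H,\mathbf L]=(T_{[\mathbf H,\mathbf L]},r)$ with $r(\alpha,\beta)=\bigwedge_{x\in A}(\beta(x)\rightarrow\alpha(F(x)))$. -}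

module Defs where

open import Level using (Level; suc; _⊔_)
open import Data.Product using (Σ; _×_; _,_; proj₁; proj₂)
open import Relation.Binary.PropositionalEquality using (_≡_)
open import Relation.Binary.Structures using (IsPartialOrder)

record CompleteLattice (ℓ : Level) : Set (suc ℓ) where
  field
    Carrier    : Set ℓ
    _≤_        : Carrier → Carrier → Set ℓ
    isPartialOrder : IsPartialOrder _≡_ _≤_
    ⋁          : {I : Set ℓ} → (I → Carrier) → Carrier
    ⋁-upper    : {I : Set ℓ} (a : I → Carrier) (i : I) → a i ≤ ⋁ a
    ⋁-least    : {I : Set ℓ} (a : I → Carrier) (b : Carrier) →
                 ((i : I) → a i ≤ b) → ⋁ a ≤ b

  ⋀ : {I : Set ℓ} → (I → Carrier) → Carrier
  ⋀ {I} a = ⋁ {Σ Carrier (λ v → (i : I) → v ≤ a i)} proj₁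

record Quantale (ℓ : Level) : Set (suc ℓ) where
  field
    lattice : CompleteLattice ℓ
  open CompleteLattice lattice public
  field
    _⊗_      : Carrier → Carrier → Carrier
    e        : Carrier
    ⊗-assoc  : ∀ u v w → (u ⊗ v) ⊗ w ≡ u ⊗ (v ⊗ w)
    ⊗-comm   : ∀ u v → u ⊗ v ≡ v ⊗ u
    ⊗-identityˡ : ∀ u → e ⊗ u ≡ u
    ⊗-distribˡ-⋁ : ∀ u {I : Set ℓ} (v : I → Carrier) → u ⊗ ⋁ v ≡ ⋁ (λ i → u ⊗ v i)
    ⊗-distribʳ-⋁ : ∀ {I : Set ℓ} (v : I → Carrier) u → ⋁ v ⊗ u ≡ ⋁ (λ i → v i ⊗ u)

module _ {ℓ : Level} (V : Quantale ℓ) where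
  private module V = Quantale V

  record Module : Set (suc ℓ) where
    field
      lattice : CompleteLattice ℓ
    open CompleteLattice lattice public
    field
      _*_ : V.Carrier → Carrier → Carrier
      *-distribˡ-⋁ : ∀ u {I : Set ℓ} (a : I → Carrier) → u * ⋁ a ≡ ⋁ (λ i → u * a i)
      *-distribʳ-⋁ : ∀ {I : Set ℓ} (v : I → V.Carrier) a → V.⋁ v * a ≡ ⋁ (λ i → v i * a)
      *-assoc : ∀ u v a → u * (v * a) ≡ (u V.⊗ v) * a
      *-identity : ∀ a → V.e * a ≡ a

  record IsModuleHom (A B : Module) (h : Module.Carrier A → Module.Carrier B) : Set (suc ℓ) where
    private
      module A = Module A
      module B = Module B
    field
      preserves-⋁ : ∀ {I : Set ℓ} (a : I → A.Carrier) → h (A.⋁ a) ≡ B.⋁ (λ i → h (a i))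
      preserves-* : ∀ v a → h (v A.* a) ≡ v B.* h a

  ModuleHom : Module → Module → Set (suc ℓ)
  ModuleHom A B = Σ (Module.Carrier A → Module.Carrier B) (IsModuleHom A B)

  record Frame : Set (suc (suc ℓ)) where
    field
      T : Set (suc ℓ)
      r : T → T → V.Carrier

  IsFrameHom : (X Y : Frame) → (Frame.T X → Frame.T Y) → Set (suc ℓ)
  IsFrameHom X Y g = ∀ i j → Frame.r X i j V.≤ Frame.r Y (g i) (g j)

  record FSemilattice : Set (suc ℓ) where
    field
      A : Module
      F : ModuleHom A A

  residual : (L : Module) → Module.Carrier L → Module.Carrier L → V.Carrier
  residual L a b = V.⋁ {Σ V.Carrier (λ v → Module._≤_ L (Module._*_ L v a) b)} proj₁

  THom : FSemilattice → Module → Set (suc ℓ)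
  THom H L = ModuleHom (FSemilattice.A H) L

  J : FSemilattice → Module → Frame
  J H L = record
    { T = THom H L
    ; r = λ α β → V.⋀ {Module.Carrier (FSemilattice.A H)}
                     (λ x → residual L (proj₁ β x)
                                       (proj₁ α (proj₁ (FSemilattice.F H) x)))
    }

-- A module homomorphism preserves joins, hence order,
-- and commutes with the action; so every v with v * a ≤ b also satisfies
-- v * f a ≤ f b, giving a → b ≤ f a → f b. Taking meets over x yields
-- r(α,β) ≤ r(f∘α, f∘β). Functoriality holds pointwise because J[H,f] α = f ∘ α.
module Submission where

open import Defs
open import Level using (Level; Lift; lift)
open import Data.Bool using (Bool; true; false)
open import Data.Product using (Σ; _×_; _,_; proj₁; proj₂)
open import Function using (_∘_)
open import Relation.Binary.PropositionalEquality using (_≡_; refl; trans; cong; subst; sym)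
open import Relation.Binary.Structures using (IsPartialOrder)

module _ {ℓ : Level} (L : CompleteLattice ℓ) where
  open CompleteLattice L

  pair : Carrier → Carrier → Lift ℓ Bool → Carrier
  pair a b (lift true)  = a
  pair a b (lift false) = b

  ≤⇒⋁-pair≡ʳ : ∀ {a b} → a ≤ b → ⋁ (pair a b) ≡ b
  ≤⇒⋁-pair≡ʳ {a} {b} a≤b =
    IsPartialOrder.antisym isPartialOrder (⋁-least (pair a b) b bounded) (⋁-upper (pair a b) (lift false))
    where
    bounded : ∀ i → pair a b i ≤ b
    bounded (lift true)  = a≤b
    bounded (lift false) = IsPartialOrder.refl isPartialOrder

  ⋀-mono : {I : Set ℓ} (a b : I → Carrier) → (∀ i → a i ≤ b i) → ⋀ a ≤ ⋀ b
  ⋀-mono a b a≤b = ⋁-least proj₁ (⋀ b) λ { (v , v≤a) →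
    ⋁-upper proj₁ (v , λ i → IsPartialOrder.trans isPartialOrder (v≤a i) (a≤b i)) }

⋁-preserving⇒monotone : {ℓ : Level} (L₁ L₂ : CompleteLattice ℓ)
  (h : CompleteLattice.Carrier L₁ → CompleteLattice.Carrier L₂) →
  (∀ {I : Set ℓ} (a : I → CompleteLattice.Carrier L₁) →
     h (CompleteLattice.⋁ L₁ a) ≡ CompleteLattice.⋁ L₂ (h ∘ a)) →
  ∀ {a b} → CompleteLattice._≤_ L₁ a b → CompleteLattice._≤_ L₂ (h a) (h b)
⋁-preserving⇒monotone L₁ L₂ h preserves-⋁ {a} {b} a≤b =
  subst (L₂._≤_ (h a)) h⋁≡hb (L₂.⋁-upper (h ∘ pair L₁ a b) (lift true))
  where
  module L₂ = CompleteLattice L₂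
  h⋁≡hb : L₂.⋁ (h ∘ pair L₁ a b) ≡ h b
  h⋁≡hb = trans (sym (preserves-⋁ (pair L₁ a b))) (cong h (≤⇒⋁-pair≡ʳ L₁ a≤b))

module _ {ℓ : Level} {V : Quantale ℓ} where
  private module V = Quantale V
  open Module using (Carrier; _≤_)

  _∘ᴹ_ : {L₁ L₂ L₃ : Module V} → ModuleHom V L₂ L₃ → ModuleHom V L₁ L₂ → ModuleHom V L₁ L₃
  (g , g-hom) ∘ᴹ (f , f-hom) = g ∘ f , record
    { preserves-⋁ = λ a → trans (cong g (F.preserves-⋁ a)) (G.preserves-⋁ (f ∘ a))
    ; preserves-* = λ v a → trans (cong g (F.preserves-* v a)) (G.preserves-* v (f a))
    }
    where
    module F = IsModuleHom f-hom
    module G = IsModuleHom g-hom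

  moduleHom-monotone : {L₁ L₂ : Module V} (f : ModuleHom V L₁ L₂) →
    ∀ {a b} → _≤_ L₁ a b → _≤_ L₂ (proj₁ f a) (proj₁ f b)
  moduleHom-monotone {L₁} {L₂} (f , f-hom) =
    ⋁-preserving⇒monotone (Module.lattice L₁) (Module.lattice L₂) f (IsModuleHom.preserves-⋁ f-hom)

  residual-moduleHom : {L₁ L₂ : Module V} (f : ModuleHom V L₁ L₂) (a b : Carrier L₁) →
    residual V L₁ a b V.≤ residual V L₂ (proj₁ f a) (proj₁ f b)
  residual-moduleHom {L₁} {L₂} f a b = V.⋁-least proj₁ _ λ { (v , va≤b) →
    V.⋁-upper proj₁ (v , subst (λ c → _≤_ L₂ c (proj₁ f b))
                               (IsModuleHom.preserves-* (proj₂ f) v a)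
                               (moduleHom-monotone f va≤b)) }

  postcompose-isFrameHom : (H : FSemilattice V) {L₁ L₂ : Module V} (f : ModuleHom V L₁ L₂) →
    IsFrameHom V (J V H L₁) (J V H L₂) (f ∘ᴹ_)
  postcompose-isFrameHom H f α β = ⋀-mono V.lattice _ _ λ x →
    residual-moduleHom f (proj₁ β x) (proj₁ α (proj₁ (FSemilattice.F H) x))

mainTheorem9 : {ℓ : Level} (V : Quantale ℓ) (H : FSemilattice V) →
    Σ ((L₁ L₂ : Module V) → ModuleHom V L₁ L₂ → THom V H L₁ → THom V H L₂)
      (λ Jf →
        ((L₁ L₂ : Module V) (f : ModuleHom V L₁ L₂) →
          ((α : THom V H L₁) (x : Module.Carrier (FSemilattice.A H)) →
             proj₁ (Jf L₁ L₂ f α) x ≡ proj₁ f (proj₁ α x))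
          × IsFrameHom V (J V H L₁) (J V H L₂) (Jf L₁ L₂ f))
        × ((L : Module V) (idL : ModuleHom V L L) →
             ((a : Module.Carrier L) → proj₁ idL a ≡ a) →
             (α : THom V H L) (x : Module.Carrier (FSemilattice.A H)) →
               proj₁ (Jf L L idL α) x ≡ proj₁ α x)
        × ((L₁ L₂ L₃ : Module V) (f : ModuleHom V L₁ L₂) (g : ModuleHom V L₂ L₃)
           (gf : ModuleHom V L₁ L₃) →
             ((a : Module.Carrier L₁) → proj₁ gf a ≡ proj₁ g (proj₁ f a)) →
             (α : THom V H L₁) (x : Module.Carrier (FSemilattice.A H)) →
               proj₁ (Jf L₁ L₃ gf α) x ≡ proj₁ (Jf L₂ L₃ g (Jf L₁ L₂ f α)) x))
mainTheorem9 V H =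
  (λ L₁ L₂ f → f ∘ᴹ_) ,
  (λ L₁ L₂ f → (λ α x → refl) , postcompose-isFrameHom H f) ,
  (λ L idL idL≗id α x → idL≗id (proj₁ α x)) ,
  (λ L₁ L₂ L₃ f g gf gf≗g∘f α x → gf≗g∘f (proj₁ α x))
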